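{- Let $G = S_1+\cdots+S_r$ be a disjunctive sum of superstars, none of which is both-0 and none of which is one-sided. If Left is to move in $G$ and the number of left-0 components exceeds the number of right-0 components, then Left (moving first) has a winning strategy in $G$. Similarly, if Right is to move in $G$ and the number of right-0 components exceeds the number of left-0 components, then Right (moving first) has a winning strategy in $G$.
   Context: Games are two-player (Left and Right) combinatorial games under normal play (a player unable to move loses), written $\{\text{Left options}\mid\text{Right options}\}$. Nimbers: $*0 = 0$ has no options; $*n=\{0,*1,\dots,*(n-1)\mid 0,*1,\dots,*(n-1)\}$. A superstar is a game all of whose Left and Right options are nimbers. In a disjunctive sum a player moves in exactly one component. Superstars are classified as follows: a superstar is a nimber if it equals some nimber $*n$ as a game (e.g., Left and Right have the same options $\{0,*1,\dots,*(n-1)\}$); it is one-sided if one player has no options while the other has at least one; otherwise it is no-0 if neither player has $0$ as an option, left-0 if only Left has $0$ as an option, right-0 if only Right has $0$ as an option, and both-0 if both players have $0$ as an option. -}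

module Defs where

open import Data.Nat using (ℕ; zero; suc; _+_)
open import Data.Fin using (Fin; zero; suc; splitAt)
open import Data.Sum using (_⊎_; [_,_])
open import Data.Product using (Σ; _×_)
open import Data.List using (List; []; _∷_; length; lookup; foldr)
open import Data.List.Membership.Propositional using (_∈_; _∉_)
open import Relation.Nullary using (¬_)
open import Relation.Binary.PropositionalEquality using (_≡_; _≢_)

data Game : Set where
  mk : (nl : ℕ) → (Fin nl → Game) → (nr : ℕ) → (Fin nr → Game) → Game

mutual
  nim : ℕ → Game
  nim n = mk n (nimOpt n) n (nimOpt n)

  -- nimOpt n enumerates *0,...,*(n-1) (in reverse order)
  nimOpt : (n : ℕ) → Fin n → Game
  nimOpt (suc n) zero = nim n
  nimOpt (suc n) (suc i) = nimOpt n i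

_⊕_ : Game → Game → Game
mk nl L nr R ⊕ mk ml L' mr R' =
  mk (nl + ml) (λ k → [ (λ i → L i ⊕ mk ml L' mr R') , (λ j → mk nl L nr R ⊕ L' j) ] (splitAt nl k))
     (nr + mr) (λ k → [ (λ i → R i ⊕ mk ml L' mr R') , (λ j → mk nl L nr R ⊕ R' j) ] (splitAt nr k))

-- Normal play outcomes.
-- LWinsFirst G : Left, moving first in G, has a winning strategy.
-- LWinsSecond G : Left has a winning strategy when Right moves first in G.
mutual
  LWinsFirst : Game → Set
  LWinsFirst (mk nl L nr R) = Σ (Fin nl) (λ i → LWinsSecond (L i))

  LWinsSecond : Game → Set
  LWinsSecond (mk nl L nr R) = (j : Fin nr) → LWinsFirst (R j)

mutual
  RWinsFirst : Game → Set
  RWinsFirst (mk nl L nr R) = Σ (Fin nr) (λ j → RWinsSecond (R j))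

  RWinsSecond : Game → Set
  RWinsSecond (mk nl L nr R) = (i : Fin nl) → RWinsFirst (L i)

-- G = 0 iff G is a second-player win.
IsZeroGame : Game → Set
IsZeroGame G = LWinsSecond G × RWinsSecond G

-- Superstars: given by the lists of nimber values of the Left and Right options.
record Superstar : Set where
  constructor ss
  field
    lefts  : List ℕ
    rights : List ℕ
open Superstar public

ssGame : Superstar → Game
ssGame S = mk (length (lefts S)) (λ i → nim (lookup (lefts S) i))
              (length (rights S)) (λ i → nim (lookup (rights S) i))

-- S equals some nimber *n as a game, i.e. S + *n = 0 (since - *n = *n).
IsNimber : Superstar → Set
IsNimber S = Σ ℕ (λ n → IsZeroGame (ssGame S ⊕ nim n))

OneSidedShape : Superstar → Set
OneSidedShape S = (lefts S ≡ [] × rights S ≢ []) ⊎ (rights S ≡ [] × lefts S ≢ [])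

-- Classification (nimber takes priority, then one-sided, then the 0-based classes).
OneSided : Superstar → Set
OneSided S = ¬ IsNimber S × OneSidedShape S

Left0 : Superstar → Set
Left0 S = ¬ IsNimber S × ¬ OneSidedShape S × 0 ∈ lefts S × 0 ∉ rights S

Right0 : Superstar → Set
Right0 S = ¬ IsNimber S × ¬ OneSidedShape S × 0 ∉ lefts S × 0 ∈ rights S

Both0 : Superstar → Set
Both0 S = ¬ IsNimber S × ¬ OneSidedShape S × 0 ∈ lefts S × 0 ∈ rights S

sumSS : List Superstar → Game
sumSS = foldr (λ S G → ssGame S ⊕ G) (nim 0)

data Count {A : Set} (P : A → Set) : List A → ℕ → Set where
  cnil : Count P [] 0
  cyes : ∀ {x xs k} → P x → Count P xs k → Count P (x ∷ xs) (suc k)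
  cno  : ∀ {x xs k} → ¬ P x → Count P xs k → Count P (x ∷ xs) k

-- Say Left moves first. Left-0 components are spares: Left may move them to 0, Right may not.
-- Right-0 components are hostile, and every other admissible component S plays, for Left, like
-- a Nim heap of some size n: Right cannot move S to *n, and Left can move S to each *j with
-- j < n. Here n = 0 if Right cannot move to 0; otherwise S is the nimber *n and these two facts
-- are its mex property.
--
-- While hostile components remain, Left removes one per turn; a Right move costs at most one
-- spare and creates no hostile component, so spares stay ahead of hostiles. Without hostile
-- components Left plays Nim on the heap sizes: he moves to a P-position, spending a spare if the
-- position already is one, and keeps it one, since every Right move is either a Nim move or a
-- move above a heap's size, which Left reverses.
--
-- Whether a component is a nimber is never decided: winning is decidable, so the components may
-- be classified under a double negation.

module Submission where

open import Defs
open import Data.Nat using (ℕ; zero; suc; _+_; _<_; _≤_; _≟_; z≤n; s≤s)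
open import Data.Nat.Properties using (<-cmp; ≤-refl; ≤-reflexive; ≤-trans; ≤-pred; <-trans; m<n⇒m<1+n; m<1+n⇒m<n∨m≡n; +-monoˡ-≤; +-monoʳ-≤; +-suc; m≤n+m; m+n≡0⇒n≡0)
open import Data.Nat.Induction using (<-rec)
open import Data.Nat.ListAction using (sum)
open import Data.Fin using (Fin; zero; suc; splitAt; _↑ˡ_; _↑ʳ_)
open import Data.Fin.Properties using (splitAt-↑ˡ; splitAt-↑ʳ; any?; all?)
open import Data.List using (List; []; _∷_; map; foldr; lookup)
open import Data.List.Membership.Propositional using (_∈_; _∉_)
open import Data.List.Membership.Propositional.Properties using (∈-lookup)
open import Data.List.Membership.DecPropositional _≟_ using (_∈?_)
open import Data.List.Relation.Unary.All using (All; []; _∷_; reduce)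
open import Data.List.Relation.Unary.Any using (here; index)
open import Data.List.Relation.Unary.Any.Properties using (lookup-index; ¬Any[])
open import Data.Product using (Σ; _×_; _,_; proj₁; proj₂; ∃-syntax)
open import Data.Sum using (_⊎_; inj₁; inj₂; [_,_]; fromInj₁)
open import Data.Empty using (⊥-elim)
open import Effect.Monad using (RawMonad)
open import Level using (0ℓ)
open import Relation.Binary.Definitions using (tri<; tri≈; tri>)
open import Relation.Binary.PropositionalEquality using (_≡_; _≢_; refl; sym; trans; cong; subst; subst₂)
open import Relation.Nullary using (¬_; Dec; yes; no)
open import Relation.Nullary.Decidable using (decidable-stable)
open import Relation.Nullary.Negation using (¬¬-Monad; ¬¬-map)
open import Function using (_∘_)

open RawMonad (¬¬-Monad {0ℓ}) using (pure; _>>=_)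

data Player : Set where
  Left Right : Player

opponent : Player → Player
opponent Left  = Right
opponent Right = Left

WinsFirst WinsSecond : Player → Game → Set
WinsFirst Left   = LWinsFirst
WinsFirst Right  = RWinsFirst
WinsSecond Left  = LWinsSecond
WinsSecond Right = RWinsSecond

infix 4 _⟶[_]_

data _⟶[_]_ : Game → Player → Game → Set where
  left  : ∀ {nl L nr R} (i : Fin nl) → mk nl L nr R ⟶[ Left ] L i
  right : ∀ {nl L nr R} (j : Fin nr) → mk nl L nr R ⟶[ Right ] R j

winsFirst : ∀ {p G H} → G ⟶[ p ] H → WinsSecond p H → WinsFirst p G
winsFirst (left i)  w = i , w
winsFirst (right j) w = j , w

winsFirst-move : ∀ p G → WinsFirst p G → ∃[ H ] G ⟶[ p ] H × WinsSecond p H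
winsFirst-move Left  (mk nl L nr R) (i , w) = L i , left i , w
winsFirst-move Right (mk nl L nr R) (j , w) = R j , right j , w

winsSecond-reply : ∀ p {G H} → WinsSecond p G → G ⟶[ opponent p ] H → WinsFirst p H
winsSecond-reply Left  w (right j) = w j
winsSecond-reply Right w (left i)  = w i

mutual
  winsFirst⇒¬winsSecond : ∀ p G → WinsFirst p G → ¬ WinsSecond (opponent p) G
  winsFirst⇒¬winsSecond Left  (mk nl L nr R) (i , w) v = winsSecond⇒¬winsFirst Left  (L i) w (v i)
  winsFirst⇒¬winsSecond Right (mk nl L nr R) (j , w) v = winsSecond⇒¬winsFirst Right (R j) w (v j)

  winsSecond⇒¬winsFirst : ∀ p G → WinsSecond p G → ¬ WinsFirst (opponent p) G
  winsSecond⇒¬winsFirst Left  (mk nl L nr R) w (j , v) = winsFirst⇒¬winsSecond Left  (R j) (w j) v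
  winsSecond⇒¬winsFirst Right (mk nl L nr R) w (i , v) = winsFirst⇒¬winsSecond Right (L i) (w i) v

mutual
  winsFirst? : ∀ p G → Dec (WinsFirst p G)
  winsFirst? Left  (mk nl L nr R) = any? λ i → winsSecond? Left  (L i)
  winsFirst? Right (mk nl L nr R) = any? λ j → winsSecond? Right (R j)

  winsSecond? : ∀ p G → Dec (WinsSecond p G)
  winsSecond? Left  (mk nl L nr R) = all? λ j → winsFirst? Left  (R j)
  winsSecond? Right (mk nl L nr R) = all? λ i → winsFirst? Right (L i)

Maintainable : {A : Set} → (A → Player → A → Set) → Player → (A → Set) → Set
Maintainable _⇒[_]_ p Good = ∀ {x y} → Good x → x ⇒[ opponent p ] y → ∃[ z ] y ⇒[ p ] z × Good z

mutual
  maintainable⇒winsSecond : ∀ p {Good} → Maintainable _⟶[_]_ p Good → ∀ G → Good G → WinsSecond p G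
  maintainable⇒winsSecond Left  reply (mk nl L nr R) g j =
    maintainable⇒winsFirst Left reply (R j) (reply g (right j))
  maintainable⇒winsSecond Right reply (mk nl L nr R) g i =
    maintainable⇒winsFirst Right reply (L i) (reply g (left i))

  maintainable⇒winsFirst : ∀ p {Good} → Maintainable _⟶[_]_ p Good →
    ∀ G → ∃[ H ] G ⟶[ p ] H × Good H → WinsFirst p G
  maintainable⇒winsFirst p reply (mk nl L nr R) (_ , left i , g)  = i , maintainable⇒winsSecond Left reply (L i) g
  maintainable⇒winsFirst p reply (mk nl L nr R) (_ , right j , g) = j , maintainable⇒winsSecond Right reply (R j) g

⟶-⊕ˡ : ∀ {p A A'} B → A ⟶[ p ] A' → A ⊕ B ⟶[ p ] A' ⊕ B
⟶-⊕ˡ (mk ml L' mr R') (left {nl} i) =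
  subst (_ ⟶[ Left ]_) (cong [ _ , _ ] (splitAt-↑ˡ nl i ml)) (left (i ↑ˡ ml))
⟶-⊕ˡ (mk ml L' mr R') (right {nr = nr} j) =
  subst (_ ⟶[ Right ]_) (cong [ _ , _ ] (splitAt-↑ˡ nr j mr)) (right (j ↑ˡ mr))

⟶-⊕ʳ : ∀ {p B B'} A → B ⟶[ p ] B' → A ⊕ B ⟶[ p ] A ⊕ B'
⟶-⊕ʳ (mk nl L nr R) (left {ml} i) =
  subst (_ ⟶[ Left ]_) (cong [ _ , _ ] (splitAt-↑ʳ nl ml i)) (left (nl ↑ʳ i))
⟶-⊕ʳ (mk nl L nr R) (right {nr = mr} j) =
  subst (_ ⟶[ Right ]_) (cong [ _ , _ ] (splitAt-↑ʳ nr mr j)) (right (nr ↑ʳ j))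

⟶-⊕-inv : ∀ {p} A B {H} → A ⊕ B ⟶[ p ] H →
  (∃[ A' ] A ⟶[ p ] A' × H ≡ A' ⊕ B) ⊎ (∃[ B' ] B ⟶[ p ] B' × H ≡ A ⊕ B')
⟶-⊕-inv (mk nl L nr R) (mk ml L' mr R') (left k) with splitAt nl k
... | inj₁ i = inj₁ (L i , left i , refl)
... | inj₂ j = inj₂ (L' j , left j , refl)
⟶-⊕-inv (mk nl L nr R) (mk ml L' mr R') (right k) with splitAt nr k
... | inj₁ i = inj₁ (R i , right i , refl)
... | inj₂ j = inj₂ (R' j , right j , refl)

nimOpt-nim : ∀ n (i : Fin n) → ∃[ j ] j < n × nimOpt n i ≡ nim j
nimOpt-nim (suc n) zero    = n , ≤-refl , refl
nimOpt-nim (suc n) (suc i) with nimOpt-nim n i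
... | j , j<n , eq = j , m<n⇒m<1+n j<n , eq

nimOpt-index : ∀ {n j} → j < n → Σ (Fin n) λ i → nimOpt n i ≡ nim j
nimOpt-index {suc n} j<1+n with m<1+n⇒m<n∨m≡n j<1+n
... | inj₂ refl = zero , refl
... | inj₁ j<n with nimOpt-index j<n
...   | i , eq = suc i , eq

impartialMove : ∀ p {n f} (i : Fin n) → mk n f n f ⟶[ p ] f i
impartialMove Left  = left
impartialMove Right = right

nim-⟶ : ∀ {p n j} → j < n → nim n ⟶[ p ] nim j
nim-⟶ {p} {n} j<n with nimOpt-index j<n
... | i , eq = subst (nim n ⟶[ p ]_) eq (impartialMove p i)

nim-⟶-inv : ∀ {p n H} → nim n ⟶[ p ] H → ∃[ j ] j < n × H ≡ nim j
nim-⟶-inv {n = n} (left i)  = nimOpt-nim n i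
nim-⟶-inv {n = n} (right i) = nimOpt-nim n i

nim-zero : ∀ p n → WinsSecond p (nim n ⊕ nim n)
nim-zero p n = maintainable⇒winsSecond p mirror _ (n , refl)
  where
  Mirrored : Game → Set
  Mirrored G = ∃[ n ] G ≡ nim n ⊕ nim n

  mirror : Maintainable _⟶[_]_ p Mirrored
  mirror (n , refl) m with ⟶-⊕-inv (nim n) (nim n) m
  ... | inj₁ (_ , m' , refl) with nim-⟶-inv m'
  ...   | j , j<n , refl = _ , ⟶-⊕ʳ (nim j) (nim-⟶ j<n) , j , refl
  mirror (n , refl) m | inj₂ (_ , m' , refl) with nim-⟶-inv m'
  ...   | j , j<n , refl = _ , ⟶-⊕ˡ (nim j) (nim-⟶ j<n) , j , refl

nim-fuzzy : ∀ p {a b} → a ≢ b → WinsFirst p (nim a ⊕ nim b)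
nim-fuzzy p {a} {b} a≢b with <-cmp a b
... | tri< a<b _ _ = winsFirst {p} (⟶-⊕ʳ (nim a) (nim-⟶ a<b)) (nim-zero p a)
... | tri≈ _ a≡b _ = ⊥-elim (a≢b a≡b)
... | tri> _ _ b<a = winsFirst {p} (⟶-⊕ˡ (nim b) (nim-⟶ b<a)) (nim-zero p b)

side : Player → Superstar → List ℕ
side Left  = lefts
side Right = rights

superstar-⟶ : ∀ {p S j} → j ∈ side p S → ssGame S ⟶[ p ] nim j
superstar-⟶ {Left} {S} j∈ =
  subst (λ k → ssGame S ⟶[ Left ] nim k) (sym (lookup-index j∈)) (left (index j∈))
superstar-⟶ {Right} {S} j∈ =
  subst (λ k → ssGame S ⟶[ Right ] nim k) (sym (lookup-index j∈)) (right (index j∈))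

superstar-⟶-inv : ∀ {p S H} → ssGame S ⟶[ p ] H → ∃[ j ] j ∈ side p S × H ≡ nim j
superstar-⟶-inv {S = S} (left i)  = lookup (lefts S) i  , ∈-lookup i , refl
superstar-⟶-inv {S = S} (right j) = lookup (rights S) j , ∈-lookup j , refl

zeroGame⇒winsSecond : ∀ {G} → IsZeroGame G → ∀ p → WinsSecond p G
zeroGame⇒winsSecond (wL , _) Left  = wL
zeroGame⇒winsSecond (_ , wR) Right = wR

mex-excluded : ∀ p {S n} → WinsSecond p (ssGame S ⊕ nim n) → n ∉ side (opponent p) S
mex-excluded p {S} {n} w n∈ =
  winsFirst⇒¬winsSecond p _ (winsSecond-reply p w (⟶-⊕ˡ (nim n) (superstar-⟶ {S = S} n∈)))
    (nim-zero (opponent p) n)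

-- p answers the opponent's move *n → *j. An answer *j → *m loses, as the opponent replies S → *m,
-- so the answer is S → *v, and v = j because *v ⊕ *j is a first-player win otherwise.
mex-included : ∀ p {S n j} → WinsSecond p (ssGame S ⊕ nim n) → j < n →
  (∀ m → m < j → m ∈ side (opponent p) S) → j ∈ side p S
mex-included p {S} {j = j} w j<n below
  with winsFirst-move p _ (winsSecond-reply p w (⟶-⊕ʳ (ssGame S) (nim-⟶ j<n)))
... | _ , m , w' with ⟶-⊕-inv (ssGame S) (nim j) m
...   | inj₁ (_ , m' , refl) with superstar-⟶-inv {S = S} m'
...     | v , v∈ , refl with v ≟ j
...       | yes refl = v∈
...       | no v≢j   = ⊥-elim (winsSecond⇒¬winsFirst p _ w' (nim-fuzzy (opponent p) v≢j))
mex-included p {S} {j = j} w j<n below | _ , m , w' | inj₂ (_ , m' , refl) with nim-⟶-inv m'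
...     | k , k<j , refl = ⊥-elim (mex-excluded p {S} w' (below k k<j))

zeroSum⇒mex : ∀ {S n} → IsZeroGame (ssGame S ⊕ nim n) →
  ∀ p → n ∉ side p S × (∀ j → j < n → j ∈ side p S)
zeroSum⇒mex {S} {n} z p = excluded p , λ j j<n → <-rec _ included j j<n p
  where
  excluded : ∀ p → n ∉ side p S
  excluded Left  = mex-excluded Right {S} (zeroGame⇒winsSecond z Right)
  excluded Right = mex-excluded Left  {S} (zeroGame⇒winsSecond z Left)

  included : ∀ j → (∀ {m} → m < j → m < n → ∀ p → m ∈ side p S) → j < n → ∀ p → j ∈ side p S
  included j ih j<n p =
    mex-included p {S} (zeroGame⇒winsSecond z p) j<n λ m m<j → ih m<j (<-trans m<j j<n) (opponent p)

data Component : Set where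
  superstar : Superstar → Component
  nimber    : ℕ → Component

⟦_⟧ : Component → Game
⟦ superstar S ⟧ = ssGame S
⟦ nimber k ⟧    = nim k

Option : Player → Component → ℕ → Set
Option p (superstar S) j = j ∈ side p S
Option p (nimber k)    j = j < k

component-⟶ : ∀ {p} c {j} → Option p c j → ⟦ c ⟧ ⟶[ p ] nim j
component-⟶ (superstar S) = superstar-⟶
component-⟶ (nimber k)    = nim-⟶

component-⟶-inv : ∀ {p} c {H} → ⟦ c ⟧ ⟶[ p ] H → ∃[ j ] Option p c j × H ≡ nim j
component-⟶-inv (superstar S) = superstar-⟶-inv
component-⟶-inv (nimber k)    = nim-⟶-inv

position : List Component → Game
position = foldr (λ c G → ⟦ c ⟧ ⊕ G) (nim 0)

infix 4 _↝[_]_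

data _↝[_]_ : List Component → Player → List Component → Set where
  here  : ∀ {p c cs j} → Option p c j → c ∷ cs ↝[ p ] nimber j ∷ cs
  there : ∀ {p c cs cs'} → cs ↝[ p ] cs' → c ∷ cs ↝[ p ] c ∷ cs'

↝⇒⟶ : ∀ {p cs cs'} → cs ↝[ p ] cs' → position cs ⟶[ p ] position cs'
↝⇒⟶ {cs = c ∷ cs} (here o)  = ⟶-⊕ˡ (position cs) (component-⟶ c o)
↝⇒⟶ {cs = c ∷ _}  (there m) = ⟶-⊕ʳ ⟦ c ⟧ (↝⇒⟶ m)

⟶⇒↝ : ∀ {p} cs {H} → position cs ⟶[ p ] H → ∃[ cs' ] cs ↝[ p ] cs' × H ≡ position cs'
⟶⇒↝ [] m with nim-⟶-inv m
... | _ , () , _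
⟶⇒↝ (c ∷ cs) m with ⟶-⊕-inv ⟦ c ⟧ (position cs) m
... | inj₁ (_ , m' , refl) with component-⟶-inv c m'
...   | j , o , refl = nimber j ∷ cs , here o , refl
⟶⇒↝ (c ∷ cs) m | inj₂ (_ , m' , refl) with ⟶⇒↝ cs m'
...   | cs' , m'' , refl = c ∷ cs' , there m'' , refl

maintainable↝⇒winsFirst : ∀ p {Good cs cs'} → Maintainable _↝[_]_ p Good →
  cs ↝[ p ] cs' → Good cs' → WinsFirst p (position cs)
maintainable↝⇒winsFirst p {Good} reply m g =
  maintainable⇒winsFirst p reply' _ (_ , ↝⇒⟶ m , _ , refl , g)
  where
  GoodGame : Game → Set
  GoodGame G = ∃[ cs ] G ≡ position cs × Good cs

  reply' : Maintainable _⟶[_]_ p GoodGame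
  reply' (cs , refl , g) m with ⟶⇒↝ cs m
  ... | _ , m' , refl with reply g m'
  ...   | cs'' , m'' , g'' = _ , ↝⇒⟶ m'' , cs'' , refl , g''

data HeapMove : List ℕ → List ℕ → Set where
  here  : ∀ {n hs j} → j < n → HeapMove (n ∷ hs) (j ∷ hs)
  there : ∀ {n hs hs'} → HeapMove hs hs' → HeapMove (n ∷ hs) (n ∷ hs')

heapMove⇒↝ : ∀ {p hs hs'} → HeapMove hs hs' → map nimber hs ↝[ p ] map nimber hs'
heapMove⇒↝ (here j<n)  = here j<n
heapMove⇒↝ (there hm) = there (heapMove⇒↝ hm)

↝⇒heapMove : ∀ {p} hs {cs} → map nimber hs ↝[ p ] cs → ∃[ hs' ] HeapMove hs hs' × cs ≡ map nimber hs'
↝⇒heapMove (n ∷ hs) (here {j = j} j<n) = j ∷ hs , here j<n , refl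
↝⇒heapMove (n ∷ hs) (there m) with ↝⇒heapMove hs m
... | hs' , hm , refl = n ∷ hs' , there hm , refl

data Impartial : Game → Set where
  impartial : ∀ {n f} → (∀ i → Impartial (f i)) → Impartial (mk n f n f)

mutual
  impartial-nim : ∀ n → Impartial (nim n)
  impartial-nim n = impartial (impartial-nimOpt n)

  impartial-nimOpt : ∀ n (i : Fin n) → Impartial (nimOpt n i)
  impartial-nimOpt (suc n) zero    = impartial-nim n
  impartial-nimOpt (suc n) (suc i) = impartial-nimOpt n i

impartial-⊕ : ∀ {A B} → Impartial A → Impartial B → Impartial (A ⊕ B)
impartial-⊕ (impartial {n} hf) (impartial hg) =
  impartial λ k → impartial-[,] (λ i → impartial-⊕ (hf i) (impartial hg))
                                (λ j → impartial-⊕ (impartial hf) (hg j)) (splitAt n k)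
  where
  impartial-[,] : ∀ {a b} {F : Fin a → Game} {G : Fin b → Game} →
    (∀ i → Impartial (F i)) → (∀ j → Impartial (G j)) → ∀ x → Impartial ([ F , G ] x)
  impartial-[,] hF hG (inj₁ i) = hF i
  impartial-[,] hF hG (inj₂ j) = hG j

impartial-dichotomy : ∀ {G} → Impartial G → LWinsFirst G ⊎ LWinsSecond G
impartial-dichotomy {G} (impartial hf) with winsFirst? Left G
... | yes w  = inj₁ w
... | no ¬w = inj₂ λ j → fromInj₁ (λ w → ⊥-elim (¬w (j , w))) (impartial-dichotomy (hf j))

nimPosition : List ℕ → Game
nimPosition hs = position (map nimber hs)

-- The P-positions of Nim, read off the game tree; Nim is impartial, so taking Left's view loses nothing.
PPosition : List ℕ → Set
PPosition hs = LWinsSecond (nimPosition hs)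

impartial-nimPosition : ∀ hs → Impartial (nimPosition hs)
impartial-nimPosition []       = impartial-nim 0
impartial-nimPosition (h ∷ hs) = impartial-⊕ (impartial-nim h) (impartial-nimPosition hs)

winsFirst⇒heapMove : ∀ hs → LWinsFirst (nimPosition hs) → ∃[ hs' ] HeapMove hs hs' × PPosition hs'
winsFirst⇒heapMove hs w with winsFirst-move Left _ w
... | _ , m , w' with ⟶⇒↝ (map nimber hs) m
...   | _ , m' , refl with ↝⇒heapMove hs m'
...     | hs' , hm , refl = hs' , hm , w'

PPosition-or-heapMove : ∀ hs → PPosition hs ⊎ ∃[ hs' ] HeapMove hs hs' × PPosition hs'
PPosition-or-heapMove hs with impartial-dichotomy (impartial-nimPosition hs)
... | inj₁ w = inj₂ (winsFirst⇒heapMove hs w)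
... | inj₂ w = inj₁ w

PPosition-reply : ∀ {hs hs'} → PPosition hs → HeapMove hs hs' → ∃[ hs'' ] HeapMove hs' hs'' × PPosition hs''
PPosition-reply {hs' = hs'} P hm = winsFirst⇒heapMove hs' (winsSecond-reply Left P (↝⇒⟶ (heapMove⇒↝ hm)))

Player0 : Player → Superstar → Set
Player0 Left  = Left0
Player0 Right = Right0

player0-zero : ∀ p {S} → Player0 p S → 0 ∈ side p S × 0 ∉ side (opponent p) S
player0-zero Left  (_ , _ , 0∈ , 0∉) = 0∈ , 0∉
player0-zero Right (_ , _ , 0∉ , 0∈) = 0∈ , 0∉

player0-exclusive : ∀ p {S} → Player0 p S → ¬ Player0 (opponent p) S
player0-exclusive p x y = proj₂ (player0-zero p x) (proj₁ (player0-zero (opponent p) y))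

player0-notOneSided : ∀ p {S} → Player0 p S → ¬ OneSidedShape S
player0-notOneSided Left  (_ , ¬shape , _) = ¬shape
player0-notOneSided Right (_ , ¬shape , _) = ¬shape

oneSidedShape : ∀ p {S} → side p S ≡ [] → side (opponent p) S ≢ [] → OneSidedShape S
oneSidedShape Left  e ne = inj₁ (e , ne)
oneSidedShape Right e ne = inj₂ (e , ne)

player0-intro : ∀ p {S} → ¬ IsNimber S → ¬ OneSidedShape S → 0 ∉ side p S → 0 ∈ side (opponent p) S →
  Player0 (opponent p) S
player0-intro Left  ¬n ¬shape 0∉ 0∈ = ¬n , ¬shape , 0∉ , 0∈
player0-intro Right ¬n ¬shape 0∉ 0∈ = ¬n , ¬shape , 0∈ , 0∉

both0-intro : ∀ p {S} → ¬ IsNimber S → ¬ OneSidedShape S → 0 ∈ side p S → 0 ∈ side (opponent p) S →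
  Both0 S
both0-intro Left  ¬n ¬shape 0∈ 0∈' = ¬n , ¬shape , 0∈ , 0∈'
both0-intro Right ¬n ¬shape 0∈ 0∈' = ¬n , ¬shape , 0∈' , 0∈

opponent0⇒option : ∀ p {S} → Player0 (opponent p) S → ∃[ j ] j ∈ side p S
opponent0⇒option p {S} x with side p S in e
... | j ∷ _ = j , here refl
... | []    = ⊥-elim (player0-notOneSided (opponent p) x
                (oneSidedShape p e λ e' → ¬Any[] (subst (0 ∈_) e' (proj₁ (player0-zero (opponent p) x)))))

¬¬nimber : ∀ p {S} → ¬ Both0 S → ¬ OneSided S → ¬ Player0 (opponent p) S → 0 ∈ side (opponent p) S →
  ¬ ¬ IsNimber S
¬¬nimber p {S} ¬both ¬oneSided ¬x 0∈ ¬n with 0 ∈? side p S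
... | yes 0∈' = ¬both (both0-intro p ¬n (λ sh → ¬oneSided (¬n , sh)) 0∈' 0∈)
... | no 0∉   = ¬x (player0-intro p ¬n (λ sh → ¬oneSided (¬n , sh)) 0∉ 0∈)

¬¬nimLike : ∀ p {S} → ¬ Both0 S → ¬ OneSided S → ¬ Player0 (opponent p) S →
  ¬ ¬ (∃[ n ] n ∉ side (opponent p) S × (∀ j → j < n → j ∈ side p S))
¬¬nimLike p {S} ¬both ¬oneSided ¬x with 0 ∈? side (opponent p) S
... | no 0∉  = pure (0 , 0∉ , λ _ ())
... | yes 0∈ = do
  n , z ← ¬¬nimber p ¬both ¬oneSided ¬x 0∈
  pure (n , proj₁ (zeroSum⇒mex z (opponent p)) , proj₂ (zeroSum⇒mex z p))

module Strategy (p : Player) where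

  data Kind : Component → Set where
    spare   : ∀ {S} → 0 ∈ side p S → 0 ∉ side (opponent p) S → Kind (superstar S)
    hostile : ∀ {S} j → j ∈ side p S → Kind (superstar S)
    nimLike : ∀ {S} n → n ∉ side (opponent p) S → (∀ j → j < n → j ∈ side p S) → Kind (superstar S)
    heap    : ∀ k → Kind (nimber k)

  isSpare isHostile value : ∀ {c} → Kind c → ℕ
  isSpare (spare _ _) = 1
  isSpare _           = 0
  isHostile (hostile _ _) = 1
  isHostile _             = 0
  value (nimLike n _ _) = n
  value (heap k)        = k
  value _               = 0

  #spare #hostile : ∀ {cs} → All Kind cs → ℕ
  #spare   = sum ∘ reduce isSpare
  #hostile = sum ∘ reduce isHostile

  values : ∀ {cs} → All Kind cs → List ℕ
  values = reduce value

  data _⇝_ {cs} (ks : All Kind cs) (hs : List ℕ) : Set where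
    moveTo : ∀ {cs'} → cs ↝[ p ] cs' → (ks' : All Kind cs') →
             #hostile ks' ≡ #hostile ks → values ks' ≡ hs → ks ⇝ hs

  there⇝ : ∀ {c cs hs} (k : Kind c) {ks : All Kind cs} → ks ⇝ hs → (k ∷ ks) ⇝ (value k ∷ hs)
  there⇝ k (moveTo m ks' eh ev) =
    moveTo (there m) (k ∷ ks') (cong (isHostile k +_) eh) (cong (value k ∷_) ev)

  reverse : ∀ {cs n m} {ks : All Kind cs} → n < m → (heap m ∷ ks) ⇝ (n ∷ values ks)
  reverse {ks = ks} n<m = moveTo (here n<m) (heap _ ∷ ks) refl refl

  reclassify : ∀ {q cs cs'} → cs ↝[ q ] cs' → (ks : All Kind cs) →
    Σ (All Kind cs') λ ks' → #spare ks ≤ suc (#spare ks') × #hostile ks' ≤ #hostile ks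
  reclassify (here {j = j} _) (k ∷ ks) =
    heap j ∷ ks , +-monoˡ-≤ (#spare ks) (isSpare≤1 k) , m≤n+m _ (isHostile k)
    where
    isSpare≤1 : ∀ {c} (k : Kind c) → isSpare k ≤ 1
    isSpare≤1 (spare _ _)     = ≤-refl
    isSpare≤1 (hostile _ _)   = z≤n
    isSpare≤1 (nimLike _ _ _) = z≤n
    isSpare≤1 (heap _)        = z≤n
  reclassify (there m) (k ∷ ks) with reclassify m ks
  ... | ks' , s≤ , h≤ =
    k ∷ ks' ,
    ≤-trans (+-monoʳ-≤ (isSpare k) s≤) (≤-reflexive (+-suc (isSpare k) _)) ,
    +-monoʳ-≤ (isHostile k) h≤

  removeHostile : ∀ {cs m} (ks : All Kind cs) → #hostile ks ≡ suc m →
    ∃[ cs' ] cs ↝[ p ] cs' × Σ (All Kind cs') λ ks' → #spare ks' ≡ #spare ks × #hostile ks' ≡ m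
  removeHostile (hostile j o ∷ ks) refl = _ , here o , heap j ∷ ks , refl , refl
  removeHostile (k@(spare _ _) ∷ ks) e with removeHostile ks e
  ... | _ , m , ks' , es , eh = _ , there m , k ∷ ks' , cong suc es , eh
  removeHostile (k@(nimLike _ _ _) ∷ ks) e with removeHostile ks e
  ... | _ , m , ks' , es , eh = _ , there m , k ∷ ks' , es , eh
  removeHostile (k@(heap _) ∷ ks) e with removeHostile ks e
  ... | _ , m , ks' , es , eh = _ , there m , k ∷ ks' , es , eh

  useSpare : ∀ {cs} (ks : All Kind cs) → 0 < #spare ks → ks ⇝ values ks
  useSpare (spare 0∈ _ ∷ ks) _           = moveTo (here 0∈) (heap 0 ∷ ks) refl refl
  useSpare (k@(hostile _ _) ∷ ks) s>0   = there⇝ k (useSpare ks s>0)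
  useSpare (k@(nimLike _ _ _) ∷ ks) s>0 = there⇝ k (useSpare ks s>0)
  useSpare (k@(heap _) ∷ ks) s>0        = there⇝ k (useSpare ks s>0)

  playHeapMove : ∀ {cs hs} (ks : All Kind cs) → HeapMove (values ks) hs → ks ⇝ hs
  playHeapMove (nimLike n _ below ∷ ks) (here j<n) = moveTo (here (below _ j<n)) (heap _ ∷ ks) refl refl
  playHeapMove (heap k ∷ ks) (here j<k)            = moveTo (here j<k) (heap _ ∷ ks) refl refl
  playHeapMove (k ∷ ks) (there hm)                 = there⇝ k (playHeapMove ks hm)

  opponentMove : ∀ {cs cs'} (ks : All Kind cs) → #hostile ks ≡ 0 → cs ↝[ opponent p ] cs' →
    Σ (All Kind cs') λ ks' →
      #hostile ks' ≡ #hostile ks × (HeapMove (values ks) (values ks') ⊎ ks' ⇝ values ks)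
  opponentMove (spare _ 0∉ ∷ ks) _ (here {j = zero} 0∈) = ⊥-elim (0∉ 0∈)
  opponentMove (spare _ _ ∷ ks)  _ (here {j = suc m} _) = heap (suc m) ∷ ks , refl , inj₂ (reverse (s≤s z≤n))
  opponentMove (hostile _ _ ∷ ks) () (here _)
  opponentMove (nimLike n n∉ _ ∷ ks) _ (here {j = m} o) with <-cmp m n
  ... | tri< m<n _ _ = heap m ∷ ks , refl , inj₁ (here m<n)
  ... | tri≈ _ refl _ = ⊥-elim (n∉ o)
  ... | tri> _ _ n<m = heap m ∷ ks , refl , inj₂ (reverse n<m)
  opponentMove (heap k ∷ ks) _ (here {j = m} m<k) = heap m ∷ ks , refl , inj₁ (here m<k)
  opponentMove (k ∷ ks) h (there mv) with opponentMove ks (m+n≡0⇒n≡0 (isHostile k) h) mv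
  ... | ks' , eh , inj₁ hm = k ∷ ks' , cong (isHostile k +_) eh , inj₁ (there hm)
  ... | ks' , eh , inj₂ r  = k ∷ ks' , cong (isHostile k +_) eh , inj₂ (there⇝ k r)

  Safe : List Component → Set
  Safe cs = Σ (All Kind cs) λ ks → suc (#hostile ks) < #spare ks ⊎ (#hostile ks ≡ 0 × PPosition (values ks))

  ⇝safe : ∀ {cs hs} {ks : All Kind cs} → #hostile ks ≡ 0 → ks ⇝ hs → PPosition hs →
    ∃[ cs' ] cs ↝[ p ] cs' × Safe cs'
  ⇝safe h (moveTo m ks' eh refl) P = _ , m , ks' , inj₂ (trans eh h , P)

  moveToSafe : ∀ {cs} (ks : All Kind cs) → #hostile ks < #spare ks → ∃[ cs' ] cs ↝[ p ] cs' × Safe cs'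
  moveToSafe ks h<s with #hostile ks in eh
  ... | suc _ with removeHostile ks eh
  ...   | _ , m , ks' , es , eh' =
    _ , m , ks' , inj₁ (subst₂ (λ h s → suc h < s) (sym eh') (sym es) h<s)
  moveToSafe ks h<s | zero with PPosition-or-heapMove (values ks)
  ...   | inj₁ P             = ⇝safe eh (useSpare ks h<s) P
  ...   | inj₂ (_ , hm , P) = ⇝safe eh (playHeapMove ks hm) P

  safe-maintainable : Maintainable _↝[_]_ p Safe
  safe-maintainable (ks , inj₁ ahead) m with reclassify m ks
  ... | ks' , s≤ , h≤ = moveToSafe ks' (≤-pred (≤-trans (s≤s (s≤s h≤)) (≤-trans ahead s≤)))
  safe-maintainable (ks , inj₂ (h , P)) m with opponentMove ks h m
  ... | _ , eh , inj₂ r = ⇝safe (trans eh h) r P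
  ... | ks' , eh , inj₁ hm with PPosition-reply P hm
  ...   | _ , hm' , P' = ⇝safe (trans eh h) (playHeapMove ks' hm') P'

  ahead⇒winsFirst : ∀ {cs} (ks : All Kind cs) → #hostile ks < #spare ks → WinsFirst p (position cs)
  ahead⇒winsFirst ks h<s with moveToSafe ks h<s
  ... | _ , m , safe = maintainable↝⇒winsFirst p safe-maintainable m safe

  classify : ∀ {Ss a b} → All (λ S → ¬ Both0 S) Ss → All (λ S → ¬ OneSided S) Ss →
    Count (Player0 p) Ss a → Count (Player0 (opponent p)) Ss b →
    ¬ ¬ (Σ (All Kind (map superstar Ss)) λ ks → #spare ks ≡ a × #hostile ks ≡ b)
  classify [] [] cnil cnil = pure ([] , refl , refl)
  classify (_ ∷ _) (_ ∷ _) (cyes x _) (cyes y _) = ⊥-elim (player0-exclusive p x y)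
  classify (_ ∷ ¬boths) (_ ∷ ¬oneSideds) (cyes x ca) (cno _ cb) = do
    ks , es , eh ← classify ¬boths ¬oneSideds ca cb
    pure (spare (proj₁ (player0-zero p x)) (proj₂ (player0-zero p x)) ∷ ks , cong suc es , eh)
  classify (_ ∷ ¬boths) (_ ∷ ¬oneSideds) (cno _ ca) (cyes y cb) = do
    ks , es , eh ← classify ¬boths ¬oneSideds ca cb
    let j , o = opponent0⇒option p y
    pure (hostile j o ∷ ks , es , cong suc eh)
  classify (¬both ∷ ¬boths) (¬oneSided ∷ ¬oneSideds) (cno _ ca) (cno ¬y cb) = do
    n , n∉ , below ← ¬¬nimLike p ¬both ¬oneSided ¬y
    ks , es , eh ← classify ¬boths ¬oneSideds ca cb
    pure (nimLike n n∉ below ∷ ks , es , eh)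

sumSS≡position : ∀ Ss → sumSS Ss ≡ position (map superstar Ss)
sumSS≡position []       = refl
sumSS≡position (S ∷ Ss) = cong (ssGame S ⊕_) (sumSS≡position Ss)

player0-majority⇒winsFirst : ∀ p {Ss a b} → All (λ S → ¬ Both0 S) Ss → All (λ S → ¬ OneSided S) Ss →
  Count (Player0 p) Ss a → Count (Player0 (opponent p)) Ss b → b < a → WinsFirst p (sumSS Ss)
player0-majority⇒winsFirst p {Ss} {a} {b} ¬boths ¬oneSideds ca cb b<a =
  decidable-stable (winsFirst? p (sumSS Ss)) (¬¬-map play (classify ¬boths ¬oneSideds ca cb))
  where
  open Strategy p
  play : Σ (All Kind (map superstar Ss)) (λ ks → #spare ks ≡ a × #hostile ks ≡ b) → WinsFirst p (sumSS Ss)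
  play (ks , es , eh) =
    subst (WinsFirst p) (sym (sumSS≡position Ss)) (ahead⇒winsFirst ks (subst₂ _<_ (sym eh) (sym es) b<a))

mainTheorem3 : (Ss : List Superstar)
    → All (λ S → ¬ Both0 S) Ss
    → All (λ S → ¬ OneSided S) Ss
    → ((a b : ℕ) → Count Left0 Ss a → Count Right0 Ss b → b < a → LWinsFirst (sumSS Ss))
      × ((a b : ℕ) → Count Left0 Ss a → Count Right0 Ss b → a < b → RWinsFirst (sumSS Ss))
mainTheorem3 Ss ¬boths ¬oneSideds =
  (λ _ _ cL cR b<a → player0-majority⇒winsFirst Left  ¬boths ¬oneSideds cL cR b<a) ,
  (λ _ _ cL cR a<b → player0-majority⇒winsFirst Right ¬boths ¬oneSideds cR cL a<b)
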